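{- Let $F$ be a forest, let $T_1,\ldots,T_\ell$ be subtrees of $F$, and let $H$ be the graph with vertex set $\{1,\ldots,\ell\}$ in which distinct $i,j$ are adjacent if and only if $T_i,T_j$ are not anticomplete. If $H$ is bipartite then $H$ is a forest.
   Context: Two subgraphs of a graph are anticomplete if their vertex sets are disjoint and no edge of the graph joins them. A tree of $F$ means a subgraph of $F$ that is a tree. -}

module Defs where

open import Data.Nat using (ℕ; _≤_)
open import Data.Fin using (Fin)
open import Data.Bool using (Bool)
open import Data.List using (List; []; _∷_; _++_; [_]; length)
open import Data.List.Relation.Unary.Linked using (Linked)
open import Data.List.Relation.Unary.Unique.Propositional using (Unique)
open import Data.Product using (Σ; ∃; _×_)
open import Relation.Binary.PropositionalEquality using (_≡_; _≢_)
open import Relation.Nullary using (¬_)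

record Graph (n : ℕ) : Set₁ where
  field
    Adj    : Fin n → Fin n → Set
    sym    : ∀ {u v} → Adj u v → Adj v u
    irrefl : ∀ {v} → ¬ Adj v v
open Graph public

-- A cycle for an (edge) relation R: distinct vertices v, w₁, …, wₖ (k ≥ 2,
-- so at least 3 vertices), consecutive ones adjacent and wₖ adjacent to v.
HasCycle : ∀ {V : Set} → (V → V → Set) → Set
HasCycle {V} R = Σ V λ v → Σ (List V) λ ws →
  (2 ≤ length ws) × Unique (v ∷ ws) × Linked R (v ∷ ws ++ [ v ])

Acyclic : ∀ {V : Set} → (V → V → Set) → Set
Acyclic R = ¬ HasCycle R

IsForest : ∀ {n} → Graph n → Set
IsForest G = Acyclic (Adj G)

data Walk {V : Set} (R : V → V → Set) : V → V → Set where
  here : ∀ {v} → Walk R v v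
  step : ∀ {u v w} → R u v → Walk R v w → Walk R u w

record Subgraph {n : ℕ} (G : Graph n) : Set₁ where
  field
    Vs      : Fin n → Set
    Es      : Fin n → Fin n → Set
    Es-sym  : ∀ {u v} → Es u v → Es v u
    Es-in   : ∀ {u v} → Es u v → Vs u × Vs v × Adj G u v
open Subgraph public

IsTree : ∀ {n} {G : Graph n} → Subgraph G → Set
IsTree S = (∃ λ v → Vs S v)
         × (∀ u v → Vs S u → Vs S v → Walk (Es S) u v)
         × Acyclic (Es S)

Anticomplete : ∀ {n} {G : Graph n} → Subgraph G → Subgraph G → Set
Anticomplete {G = G} S T =
    (∀ v → Vs S v → ¬ Vs T v)
  × (∀ u v → Vs S u → Vs T v → ¬ Adj G u v)

HAdj : ∀ {n ℓ} {G : Graph n} → (Fin ℓ → Subgraph G) → Fin ℓ → Fin ℓ → Set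
HAdj T i j = (i ≢ j) × ¬ Anticomplete (T i) (T j)

Bipartite : ∀ {V : Set} → (V → V → Set) → Set
Bipartite {V} R = Σ (V → Bool) λ c → ∀ u v → R u v → c u ≢ c v

{-# OPTIONS --safe #-}
-- Suppose H has a cycle i₀ i₁ j₂ … jₖ. Being bipartite, H has no triangles, so
-- no tree Tⱼ with j ≠ i₀, i₁ touches both T i₀ and T i₁. Walk in F from T i₀ into
-- T i₁ and on inside T i₁ to where it touches T j₂, and let yz be the last edge of
-- that walk leaving T i₀. Neither y nor z lies in any Tⱼ, j ≠ i₀, i₁, so walking on
-- through T j₂, …, T jₖ back to T i₀ and inside it to y gives a walk from z to y
-- avoiding the edge yz; in a forest every edge is a bridge. Membership in a tree
-- is not decidable, so the argument runs under double negation, which suffices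
-- for a goal of the form ¬ A.
module Submission where

open import Defs
open import Data.Nat using (ℕ; _≤_; s≤s; z≤n)
open import Data.Fin using (Fin; _≟_)
open import Data.Bool using (not)
open import Data.Bool.Properties using (¬-not; not-involutive)
open import Data.List using (List; []; _∷_; _++_; [_]; length)
open import Data.List.Relation.Unary.Linked using (Linked; [-]; _∷_)
open import Data.List.Relation.Unary.All as All using (All; []; _∷_)
open import Data.List.Relation.Unary.All.Properties using (¬Any⇒All¬)
open import Data.List.Relation.Unary.Any using (Any; here; there; any?)
open import Data.List.Relation.Unary.AllPairs using ([]; _∷_)
open import Data.List.Relation.Unary.Unique.Propositional using (Unique)
open import Data.Product using (∃; ∃₂; _×_; _,_; proj₁; proj₂)
open import Data.Sum using (_⊎_; inj₁; inj₂)
open import Data.Empty using (⊥; ⊥-elim)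
open import Effect.Monad using (RawMonad)
open import Level using (0ℓ)
open import Relation.Binary.Definitions using (DecidableEquality)
open import Relation.Binary.PropositionalEquality using (_≡_; _≢_; refl; cong; module ≡-Reasoning)
open import Relation.Nullary using (¬_; yes; no; contradiction)
open import Relation.Nullary.Decidable using (¬¬-excluded-middle)
open import Relation.Nullary.Negation using (¬¬-Monad)

open RawMonad (¬¬-Monad {a = 0ℓ})

module _ {V : Set} {R : V → V → Set} where

  infixr 5 _++ʷ_
  _++ʷ_ : ∀ {a b d} → Walk R a b → Walk R b d → Walk R a d
  here     ++ʷ w = w
  step r v ++ʷ w = step r (v ++ʷ w)

  Walk-map : ∀ {S : V → V → Set} → (∀ {u v} → R u v → S u v) → ∀ {a b} → Walk R a b → Walk S a b
  Walk-map f here       = here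
  Walk-map f (step r w) = step (f r) (Walk-map f w)

bipartite⇒triangle-free : ∀ {V : Set} {R : V → V → Set} → Bipartite R →
                          ∀ {a b d} → R a b → R b d → R a d → ⊥
bipartite⇒triangle-free (c , proper) {a} {b} {d} ab bd ad = proper a d ad (begin
  c a             ≡⟨ ¬-not (proper a b ab) ⟩
  not (c b)       ≡⟨ cong not (¬-not (proper b d bd)) ⟩
  not (not (c d)) ≡⟨ not-involutive (c d) ⟩
  c d             ∎)
  where open ≡-Reasoning

-- Last exit of a walk from P into ¬ P: decidability of P is replaced by
-- excluded middle under ¬ ¬.
module _ {V : Set} (P : V → Set) (R : V → V → Set) where

  Outside : V → V → Set
  Outside u w = ¬ P u × ¬ P w × R u w

  Exit : V → Set
  Exit v = ∃₂ λ y z → P y × ¬ P z × R y z × Walk Outside z v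

  exit-or-outside : ∀ {p v} → ¬ P v → Walk R p v → ¬ ¬ (Exit v ⊎ (¬ P p × Walk Outside p v))
  exit-or-outside ¬Pv here = pure (inj₂ (¬Pv , here))
  exit-or-outside {p} ¬Pv (step {v = q} r w) = do
    inj₂ (¬Pq , w-out) ← exit-or-outside ¬Pv w
      where inj₁ exit → pure (inj₁ exit)
    yes Pp ← ¬¬-excluded-middle {A = P p}
      where no ¬Pp → pure (inj₂ (¬Pp , step (¬Pp , ¬Pq , r) w-out))
    pure (inj₁ (p , q , Pp , ¬Pq , r , w-out))

  last-exit : ∀ {p v} → P p → ¬ P v → Walk R p v → ¬ ¬ Exit v
  last-exit Pp ¬Pv w = do
    inj₁ exit ← exit-or-outside ¬Pv w
      where inj₂ (¬Pp , _) → contradiction Pp ¬Pp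
    pure exit

-- The index lists the vertices visited after the start.
data WalkVia {V : Set} (R : V → V → Set) : V → V → List V → Set where
  end  : ∀ {x} → WalkVia R x x []
  _▸_  : ∀ {x y z vs} → R x y → WalkVia R y z vs → WalkVia R x z (y ∷ vs)

module _ {V : Set} {R : V → V → Set} where

  WalkVia-map : ∀ {S : V → V → Set} → (∀ {u v} → R u v → S u v) →
                ∀ {x z vs} → WalkVia R x z vs → WalkVia S x z vs
  WalkVia-map f end     = end
  WalkVia-map f (r ▸ w) = f r ▸ WalkVia-map f w

  WalkVia⇒Linked : ∀ {x t s vs} → WalkVia R x t vs → R t s → Linked R (x ∷ vs ++ [ s ])
  WalkVia⇒Linked end     r′ = r′ ∷ [-]
  WalkVia⇒Linked (r ▸ w) r′ = r ∷ WalkVia⇒Linked w r′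

  Path : V → V → Set
  Path x z = ∃ λ vs → WalkVia R x z vs × Unique (x ∷ vs)

  suffix-path : ∀ {x y z vs} → Any (x ≡_) (y ∷ vs) → WalkVia R y z vs → Unique (y ∷ vs) → Path x z
  suffix-path (here refl) w       u       = _ , w , u
  suffix-path (there x∈)  (r ▸ w) (_ ∷ u) = suffix-path x∈ w u

  walk⇒path : DecidableEquality V → ∀ {x z} → Walk R x z → Path x z
  walk⇒path _≟ᵥ_ here = [] , end , [] ∷ []
  walk⇒path _≟ᵥ_ {x} (step {v = y} r w) with walk⇒path _≟ᵥ_ w
  ... | vs , p , u with any? (x ≟ᵥ_) (y ∷ vs)
  ...   | yes x∈ = suffix-path x∈ p u
  ...   | no  x∉ = y ∷ vs , r ▸ p , ¬Any⇒All¬ (y ∷ vs) x∉ ∷ u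

module _ {n : ℕ} (F : Graph n) where

  OnEdge : Fin n → Fin n → Fin n → Fin n → Set
  OnEdge y z u w = (u ≡ y × w ≡ z) ⊎ (u ≡ z × w ≡ y)

  AdjWithout : Fin n → Fin n → Fin n → Fin n → Set
  AdjWithout y z u w = Adj F u w × ¬ OnEdge y z u w

  AdjWithout-path-long : ∀ {y z vs} → Adj F y z → WalkVia (AdjWithout y z) z y vs → 2 ≤ length vs
  AdjWithout-path-long yz end               = ⊥-elim (irrefl F yz)
  AdjWithout-path-long yz ((_ , off) ▸ end) = ⊥-elim (off (inj₂ (refl , refl)))
  AdjWithout-path-long yz (_ ▸ (_ ▸ _))     = s≤s (s≤s z≤n)

  forest-edge-is-bridge : IsForest F → ∀ {y z} → Adj F y z → ¬ Walk (AdjWithout y z) z y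
  forest-edge-is-bridge forest {y} {z} yz w with walk⇒path _≟_ w
  ... | vs , p , u =
    forest (z , vs , AdjWithout-path-long yz p , u , WalkVia⇒Linked (WalkVia-map proj₁ p) yz)

  module _ {P : Fin n → Set} where

    off-edge-y : ∀ {y z u w} → ¬ P y → P u → P w → ¬ OnEdge y z u w
    off-edge-y ¬Py Pu _  (inj₁ (refl , refl)) = ¬Py Pu
    off-edge-y ¬Py _  Pw (inj₂ (refl , refl)) = ¬Py Pw

    off-edge-z : ∀ {y z u w} → ¬ P z → P u → P w → ¬ OnEdge y z u w
    off-edge-z ¬Pz _  Pw (inj₁ (refl , refl)) = ¬Pz Pw
    off-edge-z ¬Pz Pu _  (inj₂ (refl , refl)) = ¬Pz Pu

    off-edge-source : ∀ {y z u w} → P u → ¬ P y → ¬ P z → ¬ OnEdge y z u w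
    off-edge-source Pu ¬Py _   (inj₁ (refl , refl)) = ¬Py Pu
    off-edge-source Pu _   ¬Pz (inj₂ (refl , refl)) = ¬Pz Pu

    off-edge-target : ∀ {y z u w} → P w → ¬ P y → ¬ P z → ¬ OnEdge y z u w
    off-edge-target Pw _   ¬Pz (inj₁ (refl , refl)) = ¬Pz Pw
    off-edge-target Pw ¬Py _   (inj₂ (refl , refl)) = ¬Py Pw

  subgraph-walk-off : ∀ {S : Subgraph F} {y z} → ¬ Vs S y ⊎ ¬ Vs S z →
                      ∀ {a b} → Walk (Es S) a b → Walk (AdjWithout y z) a b
  subgraph-walk-off {S} avoids = Walk-map λ e →
    let (u∈S , w∈S , uw) = Es-in S e in uw , off avoids u∈S w∈S
    where
    off : ∀ {y z u w} → ¬ Vs S y ⊎ ¬ Vs S z → Vs S u → Vs S w → ¬ OnEdge y z u w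
    off (inj₁ y∉S) = off-edge-y y∉S
    off (inj₂ z∉S) = off-edge-z z∉S

  touch-step : ∀ {y z p q} → p ≡ q ⊎ Adj F p q → ¬ OnEdge y z p q → Walk (AdjWithout y z) p q
  touch-step (inj₁ refl) _   = here
  touch-step (inj₂ pq)   off = step (pq , off) here

module _ {n : ℕ} {F : Graph n} where

  record Touch (S S′ : Subgraph F) : Set where
    constructor touching
    field
      {source target} : Fin n
      source∈S  : Vs S source
      target∈S′ : Vs S′ target
      link      : source ≡ target ⊎ Adj F source target

  touch⇒¬anticomplete : ∀ {S S′} → Touch S S′ → ¬ Anticomplete S S′
  touch⇒¬anticomplete (touching {p} p∈S p∈S′ (inj₁ refl)) (disjoint , _) = disjoint p p∈S p∈S′
  touch⇒¬anticomplete (touching {p} {q} p∈S q∈S′ (inj₂ pq)) (_ , nonadjacent) =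
    nonadjacent p q p∈S q∈S′ pq

  ¬anticomplete⇒¬¬touch : ∀ S S′ → ¬ Anticomplete S S′ → ¬ ¬ Touch S S′
  ¬anticomplete⇒¬¬touch S S′ ¬ac ¬touch = ¬ac
    ( (λ v v∈S v∈S′ → ¬touch (touching v∈S v∈S′ (inj₁ refl)))
    , (λ u v u∈S v∈S′ uv → ¬touch (touching u∈S v∈S′ (inj₂ uv))) )

module Overlap {n : ℕ} (F : Graph n) (forest : IsForest F)
               {ℓ : ℕ} (T : Fin ℓ → Subgraph F) (trees : ∀ i → IsTree (T i))
               (bipartite : Bipartite (HAdj T)) where

  tree-walk : ∀ i {a b} → Vs (T i) a → Vs (T i) b → Walk (Es (T i)) a b
  tree-walk i = proj₁ (proj₂ (trees i)) _ _

  module _ {i₀ i₁ : Fin ℓ} (h₀₁ : HAdj T i₀ i₁) where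

    Mid : Fin ℓ → Set
    Mid j = i₀ ≢ j × i₁ ≢ j

    mid-touches-one-side : ∀ {j} → Mid j → Touch (T i₀) (T j) → Touch (T i₁) (T j) → ⊥
    mid-touches-one-side (i₀≢j , i₁≢j) t₀ t₁ = bipartite⇒triangle-free bipartite h₀₁
      (i₁≢j , touch⇒¬anticomplete t₁) (i₀≢j , touch⇒¬anticomplete t₀)

    IntoT₁ : Fin n → Fin n → Set
    IntoT₁ u w = Adj F u w × Vs (T i₁) w

    entry-walk : ∀ {v} → Touch (T i₀) (T i₁) → Vs (T i₁) v → ∃ λ p → Vs (T i₀) p × Walk IntoT₁ p v
    entry-walk {v} (touching {a} {b} a∈T₀ b∈T₁ link) v∈T₁ =
      a , a∈T₀ , enter link (Walk-map within (tree-walk i₁ b∈T₁ v∈T₁))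
      where
      within : ∀ {u w} → Es (T i₁) u w → IntoT₁ u w
      within e = let (_ , w∈T₁ , uw) = Es-in (T i₁) e in uw , w∈T₁
      enter : a ≡ b ⊎ Adj F a b → Walk IntoT₁ b v → Walk IntoT₁ a v
      enter (inj₁ refl) w = w
      enter (inj₂ ab)   w = step (ab , b∈T₁) w

    module _ {y z : Fin n} (y∈T₀ : Vs (T i₀) y) (z∈T₁ : Vs (T i₁) z) (z∉T₀ : ¬ Vs (T i₀) z)
             (yz : Adj F y z) where

      mid∌y : ∀ {j} → Mid j → ¬ Vs (T j) y
      mid∌y m y∈Tj = mid-touches-one-side m
        (touching y∈T₀ y∈Tj (inj₁ refl)) (touching z∈T₁ y∈Tj (inj₂ (Graph.sym F yz)))

      mid∌z : ∀ {j} → Mid j → ¬ Vs (T j) z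
      mid∌z m z∈Tj = mid-touches-one-side m
        (touching y∈T₀ z∈Tj (inj₂ yz)) (touching z∈T₁ z∈Tj (inj₁ refl))

      mid-step : ∀ {j k p} → Mid j → HAdj T j k → Vs (T j) p →
                 ¬ ¬ (∃ λ q → Vs (T k) q × Walk (AdjWithout F y z) p q)
      mid-step {j} {k} m (_ , ¬ac) p∈Tj = do
        touching {_} {q} p′∈Tj q∈Tk link ← ¬anticomplete⇒¬¬touch (T j) (T k) ¬ac
        pure (q , q∈Tk , subgraph-walk-off F {S = T j} (inj₁ (mid∌y m)) (tree-walk j p∈Tj p′∈Tj)
                         ++ʷ touch-step F link (off-edge-source F p′∈Tj (mid∌y m) (mid∌z m)))

      mid-chain : ∀ js {j p} → All Mid (j ∷ js) → Linked (HAdj T) (j ∷ js ++ [ i₀ ]) →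
                  Vs (T j) p → ¬ ¬ Walk (AdjWithout F y z) p y
      mid-chain [] (m ∷ []) (h ∷ [-]) p∈Tj = do
        (q , q∈T₀ , w) ← mid-step m h p∈Tj
        pure (w ++ʷ subgraph-walk-off F {S = T i₀} (inj₂ z∉T₀) (tree-walk i₀ q∈T₀ y∈T₀))
      mid-chain (_ ∷ js) (m ∷ ms) (h ∷ l) p∈Tj = do
        (q , q∈Tk , w) ← mid-step m h p∈Tj
        rest ← mid-chain js ms l q∈Tk
        pure (w ++ʷ rest)

      outside-walk-off : ∀ {a b} → Walk (Outside (Vs (T i₀)) IntoT₁) a b → Walk (AdjWithout F y z) a b
      outside-walk-off = Walk-map λ (u∉T₀ , w∉T₀ , uw , _) →
        uw , off-edge-y F (λ y∉T₀ → y∉T₀ y∈T₀) u∉T₀ w∉T₀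

      walk-around : ∀ {v q j js} → Walk (Outside (Vs (T i₀)) IntoT₁) z v → v ≡ q ⊎ Adj F v q →
                    Vs (T j) q → All Mid (j ∷ js) → Linked (HAdj T) (j ∷ js ++ [ i₀ ]) →
                    ¬ ¬ Walk (AdjWithout F y z) z y
      walk-around {js = js} w-out link q∈Tj mids@(m ∷ _) l = do
        rest ← mid-chain js mids l q∈Tj
        pure (outside-walk-off w-out
          ++ʷ touch-step F link (off-edge-target F q∈Tj (mid∌y m) (mid∌z m))
          ++ʷ rest)

  no-cycle : ¬ HasCycle (HAdj T)
  no-cycle (i₀ , [] , () , _)
  no-cycle (i₀ , _ ∷ [] , s≤s () , _)
  no-cycle (i₀ , i₁ ∷ j₂ ∷ js , _ , ((_ ∷ i₀≢) ∷ i₁≢ ∷ _) , h₀₁ ∷ h₁₂ ∷ l) = ¬¬⊥⇒⊥ do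
    touching {v₁} v₁∈T₁ q∈T₂ link₁₂ ← ¬anticomplete⇒¬¬touch (T i₁) (T j₂) (proj₂ h₁₂)
    t₀₁ ← ¬anticomplete⇒¬¬touch (T i₀) (T i₁) (proj₂ h₀₁)
    let mids = All.zip (i₀≢ , i₁≢)
        v₁∉T₀ : ¬ Vs (T i₀) v₁
        v₁∉T₀ v₁∈T₀ = mid-touches-one-side h₀₁ (All.head mids)
          (touching v₁∈T₀ q∈T₂ link₁₂) (touching v₁∈T₁ q∈T₂ link₁₂)
        (a , a∈T₀ , w) = entry-walk h₀₁ t₀₁ v₁∈T₁
    (y , z , y∈T₀ , z∉T₀ , (yz , z∈T₁) , w-out) ← last-exit (Vs (T i₀)) (IntoT₁ h₀₁) a∈T₀ v₁∉T₀ w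
    forest-edge-is-bridge F forest yz <$> walk-around h₀₁ y∈T₀ z∈T₁ z∉T₀ yz w-out link₁₂ q∈T₂ mids l
    where
    ¬¬⊥⇒⊥ : ¬ ¬ ⊥ → ⊥
    ¬¬⊥⇒⊥ ¬¬⊥ = ¬¬⊥ λ ()

mainTheorem5 : ∀ (n : ℕ) (F : Graph n) → IsForest F →
    ∀ (ℓ : ℕ) (T : Fin ℓ → Subgraph F) → (∀ i → IsTree (T i)) →
    Bipartite (HAdj T) → Acyclic (HAdj T)
mainTheorem5 n F forest ℓ T trees bipartite = Overlap.no-cycle F forest T trees bipartite
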